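{- The group $\Gamma_0(M)$ can be generated by $T=\begin{pmatrix} 1 & 1 \\ 0 & 1\end{pmatrix}$ and elements $\gamma_1,\ldots,\gamma_n$ such that each $K\gamma_K^{ -1}\gamma_i\gamma_K$ is an Atkin--Lehner matrix $W_{K^2}(x,y,z,w)$ at level $MK^2$. Moreover, if $m$ is a prime power dividing $M$ maximally, and $W_m(a,b,c,d)$ is a corresponding Atkin--Lehner matrix at level $M$, then there exist $\mu,\nu \in \Gamma_0(M)$ such that $K\gamma_K^{ -1}\mu W_{m}(a,b,c,d)\nu\gamma_K = W_{mK^2}(x,y,z,w)$ (at level $MK^2$) for some choice of $x,y,z,w\in\mathbb{Z}$.
   Context: $K>1$ and $M$ are coprime positive integers, $\Gamma_0(M)\subset\mathrm{SL}_2(\mathbb{Z})$ is the subgroup of matrices with lower-left entry divisible by $M$, and $\gamma_K:=\begin{pmatrix} K & 0\\ 0 & 1\end{pmatrix}$. For a level $L$ and $Q\mid L$ with $\mathrm{gcd}(Q,L/Q)=1$, the Atkin--Lehner matrices at level $L$ are $W_Q(x,y,z,w):=\begin{pmatrix} Qx & y \\ Lz & Qw\end{pmatrix}$ with $x,y,z,w\in\mathbb{Z}$ and determinant $Q$. -}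

module Defs where

open import Data.Nat as ℕ using (ℕ)
open import Data.Nat.Coprimality using (Coprime)
open import Data.Integer as ℤ using (ℤ; +_; _*_; _-_; -_; 0ℤ; 1ℤ)
open import Data.Integer.Divisibility as ℤD using ()
open import Data.List using (List)
open import Data.List.Membership.Propositional using (_∈_)
open import Data.Product using (Σ; ∃-syntax; _×_)
open import Relation.Binary.PropositionalEquality using (_≡_)

-- 2x2 integer matrices  mat a b c d  =  ( a b ; c d )
data Mat : Set where
  mat : ℤ → ℤ → ℤ → ℤ → Mat

infixl 7 _⊗_
_⊗_ : Mat → Mat → Mat
mat a b c d ⊗ mat e f g h = mat (a * e ℤ.+ b * g) (a * f ℤ.+ b * h) (c * e ℤ.+ d * g) (c * f ℤ.+ d * h)

det : Mat → ℤ
det (mat a b c d) = a * d - b * c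

-- adjugate; this is the inverse for matrices of determinant 1
adj : Mat → Mat
adj (mat a b c d) = mat d (- b) (- c) a

I : Mat
I = mat 1ℤ 0ℤ 0ℤ 1ℤ

T : Mat
T = mat 1ℤ 1ℤ 0ℤ 1ℤ

γ : ℕ → Mat
γ K = mat (+ K) 0ℤ 0ℤ 1ℤ

-- K · γ_K⁻¹ = (1 0 ; 0 K)   (an integral matrix)
Kγ⁻¹ : ℕ → Mat
Kγ⁻¹ K = mat 1ℤ 0ℤ 0ℤ (+ K)

InΓ₀ : ℕ → Mat → Set
InΓ₀ M (mat a b c d) = (a * d - b * c ≡ 1ℤ) × (+ M) ℤD.∣ c

IsAL : (L Q : ℕ) → Mat → Set
IsAL L Q A =
  (∃[ L' ] (L ≡ Q ℕ.* L' × Coprime Q L')) ×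
  (∃[ x ] ∃[ y ] ∃[ z ] ∃[ w ]
     (A ≡ mat (+ Q * x) y (+ L * z) (+ Q * w))) ×
  (det A ≡ + Q)

data Gen (S : List Mat) : Mat → Set where
  gen-id  : Gen S I
  gen-mul : ∀ {s g} → s ∈ S → Gen S g → Gen S (s ⊗ g)
  gen-inv : ∀ {s g} → s ∈ S → Gen S g → Gen S (adj s ⊗ g)

{-# OPTIONS --safe #-}
module Submission where

-- Conjugation by γ_K sends (a b ; c d) to (aK b ; K²c Kd), so an element of Γ₀(M) becomes
-- K·W_{K²} at level MK² exactly when K divides both of its diagonal entries.  Since K² is
-- prime to M, S = (0 -1 ; 1 0) lifts to S′ ∈ Γ₀(M) with S′ ≡ S (mod K), and hS′⁻¹ has diagonal
-- divisible by K whenever h ∈ Γ₀(M) is diagonal modulo K.  Writing elements of SL₂(ℤ) as words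
-- in S and T and shortening words by the pigeonhole principle modulo N = MK, Schreier's lemma
-- generates Γ₀(M) by T, S′, the (finitely many) Schreier generators of the matrices diagonal
-- modulo N, and, for each short word w with value in Γ₀(M), the correction w′⁻¹w where w′ is w
-- with S replaced by S′.  All but T and S′ are diagonal modulo K.
--
-- For W = (mx y ; Mz mw), a shear (1 0 ; Mt 1) makes z₁ = z + tmx prime to K; then with
-- α L z₁ + β K = 1 (M = mL), translating by T^(-xα) and T^(-w₁α) multiplies the diagonal
-- entries by βK.

module _ where
  open import Defs
  open import Data.Nat as ℕ using (ℕ; zero; suc; _∸_; _⊓_)
  import Data.Nat.Properties as ℕP
  import Data.Nat.Divisibility as ℕD
  open import Data.Nat.Coprimality using (Coprime; coprime-Bézout; gcd≡1⇒coprime)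
  open import Data.Nat.GCD using (module Bézout; gcd; gcd[m,n]∣m; gcd[m,n]∣n; gcd[m,n]≢0)
  open import Data.Integer as ℤ using (ℤ; +_; -[1+_]; _*_; _-_; -_; 0ℤ; 1ℤ; _+_; ∣_∣; _^_)
  import Data.Integer.Properties as ℤP
  open import Data.Integer.DivMod using (_/_; _%_; a≡a%n+[a/n]*n; n%d<d)
  open import Data.Integer.Tactic.RingSolver using (solve-∀)
  import Data.Nat.Tactic.RingSolver as ℕ-RingSolver
  open import Data.Integer.Divisibility.Signed
    using ( _∣_; _∣?_; divides; ∣ᵤ⇒∣; ∣⇒∣ᵤ; ∣-refl; ∣-trans; ∣m∣n⇒∣m+n; ∣m⇒∣-m; ∣m⇒∣m*n; ∣n⇒∣m*n
          ; *-monoˡ-∣; *-monoʳ-∣; m∣∣m∣)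
  open import Data.Fin using (Fin; toℕ; fromℕ<; combine)
  import Data.Fin.Properties as FinP
  open import Data.List using (List; _∷_; []; _++_; replicate; take; drop; length; map; filter; cartesianProduct)
  import Data.List.Properties as ListP
  open import Data.List.Membership.Propositional using (_∈_)
  open import Data.List.Membership.Propositional.Properties
    using (∈-map⁺; ∈-map⁻; ∈-++⁺ˡ; ∈-++⁺ʳ; ∈-++⁻; ∈-filter⁺; ∈-filter⁻; ∈-cartesianProduct⁺)
  open import Data.List.Relation.Unary.Any using (here; there)
  open import Data.List.Relation.Unary.All as All using (All)
  open import Data.Product using (Σ; ∃-syntax; _×_; _,_; proj₁; proj₂)
  open import Data.Sum using (_⊎_; inj₁; inj₂)
  open import Data.Empty using (⊥-elim)
  open import Relation.Nullary using (yes; no; Dec)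
  open import Relation.Nullary.Decidable using (_×-dec_)
  open import Relation.Binary.PropositionalEquality
  open import Function.Bundles using (_⇔_; mk⇔)

  mat-≡ : ∀ {a b c d a′ b′ c′ d′} → a ≡ a′ → b ≡ b′ → c ≡ c′ → d ≡ d′ → mat a b c d ≡ mat a′ b′ c′ d′
  mat-≡ refl refl refl refl = refl

  ⊗-assoc : ∀ A B C → (A ⊗ B) ⊗ C ≡ A ⊗ (B ⊗ C)
  ⊗-assoc (mat a b c d) (mat e f g h) (mat i j k l) =
    mat-≡ (entry a b e f g h i k) (entry a b e f g h j l) (entry c d e f g h i k) (entry c d e f g h j l)
    where
    entry : ∀ a b e f g h i k → (a * e + b * g) * i + (a * f + b * h) * k ≡ a * (e * i + f * k) + b * (g * i + h * k)
    entry = solve-∀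

  ⊗-identityˡ : ∀ A → I ⊗ A ≡ A
  ⊗-identityˡ (mat a b c d) = mat-≡ (entry a c) (entry b d) (entry′ a c) (entry′ b d)
    where
    entry : ∀ a c → 1ℤ * a + 0ℤ * c ≡ a
    entry = solve-∀
    entry′ : ∀ a c → 0ℤ * a + 1ℤ * c ≡ c
    entry′ = solve-∀

  ⊗-identityʳ : ∀ A → A ⊗ I ≡ A
  ⊗-identityʳ (mat a b c d) = mat-≡ (entry a b) (entry′ a b) (entry c d) (entry′ c d)
    where
    entry : ∀ a b → a * 1ℤ + b * 0ℤ ≡ a
    entry = solve-∀
    entry′ : ∀ a b → a * 0ℤ + b * 1ℤ ≡ b
    entry′ = solve-∀

  det-⊗ : ∀ A B → det (A ⊗ B) ≡ det A * det B
  det-⊗ (mat a b c d) (mat e f g h) = identity a b c d e f g h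
    where
    identity : ∀ a b c d e f g h →
      (a * e + b * g) * (c * f + d * h) - (a * f + b * h) * (c * e + d * g) ≡ (a * d - b * c) * (e * h - f * g)
    identity = solve-∀

  det-adj : ∀ A → det (adj A) ≡ det A
  det-adj (mat a b c d) = identity a b c d
    where
    identity : ∀ a b c d → d * a - (- b) * (- c) ≡ a * d - b * c
    identity = solve-∀

  adj-inverseˡ : ∀ A → det A ≡ 1ℤ → adj A ⊗ A ≡ I
  adj-inverseˡ (mat a b c d) det≡1 =
    mat-≡ (trans (diag₁ a b c d) det≡1) (off₁ b d) (off₂ a c) (trans (diag₂ a b c d) det≡1)
    where
    diag₁ : ∀ a b c d → d * a + (- b) * c ≡ a * d - b * c
    diag₁ = solve-∀
    diag₂ : ∀ a b c d → (- c) * b + a * d ≡ a * d - b * c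
    diag₂ = solve-∀
    off₁ : ∀ b d → d * b + (- b) * d ≡ 0ℤ
    off₁ = solve-∀
    off₂ : ∀ a c → (- c) * a + a * c ≡ 0ℤ
    off₂ = solve-∀

  adj-inverseʳ : ∀ A → det A ≡ 1ℤ → A ⊗ adj A ≡ I
  adj-inverseʳ (mat a b c d) det≡1 =
    mat-≡ (trans (diag₁ a b c d) det≡1) (off₁ a b) (off₂ c d) (trans (diag₂ a b c d) det≡1)
    where
    diag₁ : ∀ a b c d → a * d + b * (- c) ≡ a * d - b * c
    diag₁ = solve-∀
    diag₂ : ∀ a b c d → c * (- b) + d * a ≡ a * d - b * c
    diag₂ = solve-∀
    off₁ : ∀ a b → a * (- b) + b * a ≡ 0ℤ
    off₁ = solve-∀
    off₂ : ∀ c d → c * d + d * (- c) ≡ 0ℤ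
    off₂ = solve-∀

  ⊗-adj-cancelʳ : ∀ A B → det B ≡ 1ℤ → (A ⊗ adj B) ⊗ B ≡ A
  ⊗-adj-cancelʳ A B det≡1 = begin
    (A ⊗ adj B) ⊗ B  ≡⟨ ⊗-assoc A (adj B) B ⟩
    A ⊗ (adj B ⊗ B)  ≡⟨ cong (A ⊗_) (adj-inverseˡ B det≡1) ⟩
    A ⊗ I            ≡⟨ ⊗-identityʳ A ⟩
    A                ∎
    where open ≡-Reasoning

  ⊗-cancelʳ : ∀ A B → det B ≡ 1ℤ → (A ⊗ B) ⊗ adj B ≡ A
  ⊗-cancelʳ A B det≡1 =
    trans (⊗-assoc A B (adj B)) (trans (cong (A ⊗_) (adj-inverseʳ B det≡1)) (⊗-identityʳ A))

  adj-cancelˡ : ∀ A B → det B ≡ 1ℤ → B ⊗ (adj B ⊗ A) ≡ A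
  adj-cancelˡ A B det≡1 =
    trans (sym (⊗-assoc B (adj B) A)) (trans (cong (_⊗ A) (adj-inverseʳ B det≡1)) (⊗-identityˡ A))

  upperLeft upperRight lowerLeft lowerRight : Mat → ℤ
  upperLeft (mat a b c d) = a
  upperRight (mat a b c d) = b
  lowerLeft (mat a b c d) = c
  lowerRight (mat a b c d) = d

  DiagonalMod AntidiagonalMod : ℤ → Mat → Set
  DiagonalMod k A = (k ∣ upperRight A) × (k ∣ lowerLeft A)
  AntidiagonalMod k A = (k ∣ upperLeft A) × (k ∣ lowerRight A)

  -- Γ₀(M) with signed divisibility, which has the better closure lemmas.
  Γ₀ : ℕ → Mat → Set
  Γ₀ M A = det A ≡ 1ℤ × (+ M) ∣ lowerLeft A

  InΓ₀⇒Γ₀ : ∀ {M} A → InΓ₀ M A → Γ₀ M A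
  InΓ₀⇒Γ₀ (mat a b c d) (det≡1 , M∣c) = det≡1 , ∣ᵤ⇒∣ M∣c

  Γ₀⇒InΓ₀ : ∀ {M} A → Γ₀ M A → InΓ₀ M A
  Γ₀⇒InΓ₀ (mat a b c d) (det≡1 , M∣c) = det≡1 , ∣⇒∣ᵤ M∣c

  Γ₀-I : ∀ {M} → Γ₀ M I
  Γ₀-I = refl , divides 0ℤ refl

  Γ₀-⊗ : ∀ {M} A B → Γ₀ M A → Γ₀ M B → Γ₀ M (A ⊗ B)
  Γ₀-⊗ A@(mat a b c d) B@(mat e f g h) (detA , M∣c) (detB , M∣g) =
    trans (det-⊗ A B) (cong₂ _*_ detA detB) , ∣m∣n⇒∣m+n (∣m⇒∣m*n e M∣c) (∣n⇒∣m*n d M∣g)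

  Γ₀-adj : ∀ {M} A → Γ₀ M A → Γ₀ M (adj A)
  Γ₀-adj A@(mat a b c d) (detA , M∣c) = trans (det-adj A) detA , ∣m⇒∣-m M∣c

  Gen-⊗ : ∀ {S A B} → Gen S A → Gen S B → Gen S (A ⊗ B)
  Gen-⊗ {B = B} gen-id gB = subst (Gen _) (sym (⊗-identityˡ B)) gB
  Gen-⊗ {B = B} (gen-mul {s} {g} s∈S gA) gB = subst (Gen _) (sym (⊗-assoc s g B)) (gen-mul s∈S (Gen-⊗ gA gB))
  Gen-⊗ {B = B} (gen-inv {s} {g} s∈S gA) gB = subst (Gen _) (sym (⊗-assoc (adj s) g B)) (gen-inv s∈S (Gen-⊗ gA gB))

  Gen-∈ : ∀ {S s} → s ∈ S → Gen S s
  Gen-∈ {s = s} s∈S = subst (Gen _) (⊗-identityʳ s) (gen-mul s∈S gen-id)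

  Gen-adj : ∀ {S s} → s ∈ S → Gen S (adj s)
  Gen-adj {s = s} s∈S = subst (Gen _) (⊗-identityʳ (adj s)) (gen-inv s∈S gen-id)

  Gen⇒Γ₀ : ∀ {M S} → (∀ {s} → s ∈ S → Γ₀ M s) → ∀ {A} → Gen S A → Γ₀ M A
  Gen⇒Γ₀ S⊆Γ₀ gen-id = Γ₀-I
  Gen⇒Γ₀ S⊆Γ₀ (gen-mul {s} {g} s∈S gA) = Γ₀-⊗ s g (S⊆Γ₀ s∈S) (Gen⇒Γ₀ S⊆Γ₀ gA)
  Gen⇒Γ₀ S⊆Γ₀ (gen-inv {s} {g} s∈S gA) = Γ₀-⊗ (adj s) g (Γ₀-adj s (S⊆Γ₀ s∈S)) (Gen⇒Γ₀ S⊆Γ₀ gA)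

  infix 4 _≡_[mod_]
  _≡_[mod_] : Mat → Mat → ℤ → Set
  mat a b c d ≡ mat a′ b′ c′ d′ [mod n ] = Σ ℤ λ p → Σ ℤ λ q → Σ ℤ λ r → Σ ℤ λ s →
    (a ≡ a′ + n * p) × (b ≡ b′ + n * q) × (c ≡ c′ + n * r) × (d ≡ d′ + n * s)

  ≡-mod-refl : ∀ n A → A ≡ A [mod n ]
  ≡-mod-refl n (mat a b c d) = 0ℤ , 0ℤ , 0ℤ , 0ℤ , plus0 a n , plus0 b n , plus0 c n , plus0 d n
    where
    plus0 : ∀ a n → a ≡ a + n * 0ℤ
    plus0 = solve-∀

  ≡-mod-trans : ∀ n A B C → A ≡ B [mod n ] → B ≡ C [mod n ] → A ≡ C [mod n ]
  ≡-mod-trans n (mat _ _ _ _) (mat _ _ _ _) (mat a b c d)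
    (p , q , r , s , refl , refl , refl , refl) (p′ , q′ , r′ , s′ , refl , refl , refl , refl) =
    p′ + p , q′ + q , r′ + r , s′ + s , shift a n p′ p , shift b n q′ q , shift c n r′ r , shift d n s′ s
    where
    shift : ∀ a n p q → (a + n * p) + n * q ≡ a + n * (p + q)
    shift = solve-∀

  ≡-mod-⊗ʳ : ∀ n A B C → A ≡ B [mod n ] → A ⊗ C ≡ B ⊗ C [mod n ]
  ≡-mod-⊗ʳ n (mat _ _ _ _) (mat a b c d) (mat e f g h) (p , q , r , s , refl , refl , refl , refl) =
    _ , _ , _ , _ , row a b e g n p q , row a b f h n p q , row c d e g n r s , row c d f h n r s
    where
    row : ∀ a b e g n p q → (a + n * p) * e + (b + n * q) * g ≡ (a * e + b * g) + n * (p * e + q * g)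
    row = solve-∀

  ≡-mod-⊗ˡ : ∀ n A B C → A ≡ B [mod n ] → C ⊗ A ≡ C ⊗ B [mod n ]
  ≡-mod-⊗ˡ n (mat _ _ _ _) (mat a b c d) (mat e f g h) (p , q , r , s , refl , refl , refl , refl) =
    _ , _ , _ , _ , col e f a c n p r , col e f b d n q s , col g h a c n p r , col g h b d n q s
    where
    col : ∀ e f a c n p r → e * (a + n * p) + f * (c + n * r) ≡ (e * a + f * c) + n * (e * p + f * r)
    col = solve-∀

  ≡-mod-⊗ : ∀ n A B C D → A ≡ B [mod n ] → C ≡ D [mod n ] → A ⊗ C ≡ B ⊗ D [mod n ]
  ≡-mod-⊗ n A B C D A≡B C≡D = ≡-mod-trans n _ _ _ (≡-mod-⊗ʳ n A B C A≡B) (≡-mod-⊗ˡ n C D B C≡D)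

  ≡-mod-adj : ∀ n A B → A ≡ B [mod n ] → adj A ≡ adj B [mod n ]
  ≡-mod-adj n (mat _ _ _ _) (mat a b c d) (p , q , r , s , refl , refl , refl , refl) =
    s , - q , - r , p , refl , negate b n q , negate c n r , refl
    where
    negate : ∀ b n q → - (b + n * q) ≡ - b + n * (- q)
    negate = solve-∀

  ≡I-mod⇒DiagonalMod : ∀ n A → A ≡ I [mod n ] → DiagonalMod n A
  ≡I-mod⇒DiagonalMod n (mat a b c d) (p , q , r , s , _ , refl , refl , _) =
    divides q (multiple n q) , divides r (multiple n r)
    where
    multiple : ∀ n q → 0ℤ + n * q ≡ q * n
    multiple = solve-∀

  S : Mat
  S = mat 0ℤ (- 1ℤ) 1ℤ 0ℤ

  T^ : ℤ → Mat
  T^ n = mat 1ℤ n 0ℤ 1ℤ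

  data Letter : Set where
    σ τ τ⁻¹ : Letter

  ⟦_⟧ : Letter → Mat
  ⟦ σ ⟧ = S
  ⟦ τ ⟧ = T
  ⟦ τ⁻¹ ⟧ = adj T

  eval : List Letter → Mat
  eval [] = I
  eval (l ∷ w) = ⟦ l ⟧ ⊗ eval w

  eval-++ : ∀ u v → eval (u ++ v) ≡ eval u ⊗ eval v
  eval-++ [] v = sym (⊗-identityˡ (eval v))
  eval-++ (l ∷ u) v = trans (cong (⟦ l ⟧ ⊗_) (eval-++ u v)) (sym (⊗-assoc ⟦ l ⟧ (eval u) (eval v)))

  det-eval : ∀ w → det (eval w) ≡ 1ℤ
  det-eval [] = refl
  det-eval (l ∷ w) = trans (det-⊗ ⟦ l ⟧ (eval w)) (cong₂ _*_ (det-letter l) (det-eval w))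
    where
    det-letter : ∀ l → det ⟦ l ⟧ ≡ 1ℤ
    det-letter σ = refl
    det-letter τ = refl
    det-letter τ⁻¹ = refl

  τ^ : ℤ → List Letter
  τ^ (+ n) = replicate n τ
  τ^ -[1+ n ] = replicate (suc n) τ⁻¹

  eval-τ^ : ∀ z → eval (τ^ z) ≡ T^ z
  eval-τ^ (+ zero) = refl
  eval-τ^ (+ suc n) = trans (cong (T ⊗_) (eval-τ^ (+ n))) (mat-≡ refl (step (+ n)) refl refl)
    where
    step : ∀ z → 1ℤ * z + 1ℤ * 1ℤ ≡ 1ℤ + z
    step = solve-∀
  eval-τ^ -[1+ zero ] = refl
  eval-τ^ -[1+ suc n ] = trans (cong (adj T ⊗_) (eval-τ^ -[1+ n ])) (mat-≡ refl (step -[1+ n ]) refl refl)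
    where
    step : ∀ z → 1ℤ * z + (- 1ℤ) * 1ℤ ≡ - 1ℤ + z
    step = solve-∀

  *≡1⇒±1 : ∀ a d → a * d ≡ 1ℤ → (a ≡ 1ℤ × d ≡ 1ℤ) ⊎ (a ≡ - 1ℤ × d ≡ - 1ℤ)
  *≡1⇒±1 a d ad≡1 = go a d ad≡1 (ℕP.m*n≡1⇒m≡1 ∣ a ∣ ∣ d ∣ (trans (sym (ℤP.abs-* a d)) (cong ∣_∣ ad≡1)))
    where
    go : ∀ a d → a * d ≡ 1ℤ → ∣ a ∣ ≡ 1 → (a ≡ 1ℤ × d ≡ 1ℤ) ⊎ (a ≡ - 1ℤ × d ≡ - 1ℤ)
    go (+ 1) d ad≡1 _ = inj₁ (refl , trans (sym (ℤP.*-identityˡ d)) ad≡1)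
    go -[1+ 0 ] d ad≡1 _ = inj₂ (refl , trans (sym (ℤP.neg-involutive d)) (cong -_ (trans (sym (ℤP.-1*i≡-i d)) ad≡1)))
    go (+ 0) d _ ()
    go (+ suc (suc _)) d _ ()
    go -[1+ suc _ ] d _ ()

  -- Euclid's algorithm on the first column: with a = r + q c and 0 ≤ r < ∣c∣,
  -- A = T^q S A′ where A′ has lower-left entry -r.
  euclid-factor : ∀ q r b c d → T^ q ⊗ (S ⊗ mat c d (- r) (- (b - q * d))) ≡ mat (r + q * c) b c d
  euclid-factor q r b c d = mat-≡ (e₁ q r c) (e₂ q b d) (e₃ r c) (e₄ q b d)
    where
    e₁ : ∀ q r c → 1ℤ * (0ℤ * c + (- 1ℤ) * (- r)) + q * (1ℤ * c + 0ℤ * (- r)) ≡ r + q * c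
    e₁ = solve-∀
    e₂ : ∀ q b d → 1ℤ * (0ℤ * d + (- 1ℤ) * (- (b - q * d))) + q * (1ℤ * d + 0ℤ * (- (b - q * d))) ≡ b
    e₂ = solve-∀
    e₃ : ∀ r c → 0ℤ * (0ℤ * c + (- 1ℤ) * (- r)) + 1ℤ * (1ℤ * c + 0ℤ * (- r)) ≡ c
    e₃ = solve-∀
    e₄ : ∀ q b d → 0ℤ * (0ℤ * d + (- 1ℤ) * (- (b - q * d))) + 1ℤ * (1ℤ * d + 0ℤ * (- (b - q * d))) ≡ d
    e₄ = solve-∀

  euclid-step : ∀ n a b c d .{{_ : ℤ.NonZero c}} → ∣ c ∣ ℕ.≤ n → det (mat a b c d) ≡ 1ℤ →
    (∀ A → ∣ lowerLeft A ∣ ℕ.< n → det A ≡ 1ℤ → ∃[ w ] eval w ≡ A) → ∃[ w ] eval w ≡ mat a b c d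
  euclid-step n a b c d ∣c∣≤n det≡1 recurse = τ^ q ++ σ ∷ proj₁ rest , factorisation
    where
    open ≡-Reasoning
    q r : ℤ
    q = a / c
    r = + (a % c)
    a≡r+qc : a ≡ r + q * c
    a≡r+qc = a≡a%n+[a/n]*n a c
    A′ : Mat
    A′ = mat c d (- r) (- (b - q * d))
    ∣r∣<n : ∣ - r ∣ ℕ.< n
    ∣r∣<n = ℕP.<-≤-trans (subst (ℕ._< ∣ c ∣) (sym (ℤP.∣-i∣≡∣i∣ r)) (n%d<d a c)) ∣c∣≤n
    det-factor : ∀ q r b c d → (r + q * c) * d - b * c ≡ c * (- (b - q * d)) - d * (- r)
    det-factor = solve-∀
    det′≡1 : det A′ ≡ 1ℤ
    det′≡1 = trans (sym (det-factor q r b c d)) (subst (λ x → x * d - b * c ≡ 1ℤ) a≡r+qc det≡1)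
    rest : ∃[ w ] eval w ≡ A′
    rest = recurse A′ ∣r∣<n det′≡1
    factorisation : eval (τ^ q ++ σ ∷ proj₁ rest) ≡ mat a b c d
    factorisation = begin
      eval (τ^ q ++ σ ∷ proj₁ rest)            ≡⟨ eval-++ (τ^ q) (σ ∷ proj₁ rest) ⟩
      eval (τ^ q) ⊗ (S ⊗ eval (proj₁ rest))    ≡⟨ cong₂ (λ X Y → X ⊗ (S ⊗ Y)) (eval-τ^ q) (proj₂ rest) ⟩
      T^ q ⊗ (S ⊗ A′)                          ≡⟨ euclid-factor q r b c d ⟩
      mat (r + q * c) b c d                    ≡⟨ cong (λ x → mat x b c d) (sym a≡r+qc) ⟩
      mat a b c d                              ∎

  SL₂-word : ∀ n A → ∣ lowerLeft A ∣ ℕ.< n → det A ≡ 1ℤ → ∃[ w ] eval w ≡ A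
  SL₂-word (suc n) (mat a b (+ 0) d) _ det≡1 with *≡1⇒±1 a d (trans (sym (drop-b a b d)) det≡1)
    where
    drop-b : ∀ a b d → a * d - b * 0ℤ ≡ a * d
    drop-b = solve-∀
  ... | inj₁ (refl , refl) = τ^ b , eval-τ^ b
  ... | inj₂ (refl , refl) = σ ∷ σ ∷ τ^ (- b) ,
    trans (cong (λ X → S ⊗ (S ⊗ X)) (eval-τ^ (- b))) (mat-≡ refl (e₁ b) refl (e₂ b))
    where
    e₁ : ∀ b → 0ℤ * (0ℤ * (- b) + (- 1ℤ) * 1ℤ) + (- 1ℤ) * (1ℤ * (- b) + 0ℤ * 1ℤ) ≡ b
    e₁ = solve-∀
    e₂ : ∀ b → 1ℤ * (0ℤ * (- b) + (- 1ℤ) * 1ℤ) + 0ℤ * (1ℤ * (- b) + 0ℤ * 1ℤ) ≡ - 1ℤ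
    e₂ = solve-∀
  SL₂-word (suc n) (mat a b c@(+ suc _) d) ∣c∣<n det≡1 =
    euclid-step n a b c d (ℕP.≤-pred ∣c∣<n) det≡1 (SL₂-word n)
  SL₂-word (suc n) (mat a b c@(-[1+ _ ]) d) ∣c∣<n det≡1 =
    euclid-step n a b c d (ℕP.≤-pred ∣c∣<n) det≡1 (SL₂-word n)

  ℤ-residue-injective : ∀ N .{{_ : ℕ.NonZero N}} a a′ → a % + N ≡ a′ % + N → ∃[ p ] a ≡ a′ + + N * p
  ℤ-residue-injective N a a′ same = a / + N - a′ / + N , (begin
    a                                    ≡⟨ a≡a%n+[a/n]*n a (+ N) ⟩
    + (a % + N) + a / + N * + N          ≡⟨ cong (λ r → + r + a / + N * + N) same ⟩
    + (a′ % + N) + a / + N * + N         ≡⟨ regroup (+ (a′ % + N)) (a / + N) (a′ / + N) (+ N) ⟩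
    (+ (a′ % + N) + a′ / + N * + N) + + N * (a / + N - a′ / + N)
                                         ≡⟨ cong (_+ + N * (a / + N - a′ / + N)) (sym (a≡a%n+[a/n]*n a′ (+ N))) ⟩
    a′ + + N * (a / + N - a′ / + N)      ∎)
    where
    open ≡-Reasoning
    regroup : ∀ r q q′ n → r + q * n ≡ (r + q′ * n) + n * (q - q′)
    regroup = solve-∀

  allWordsUpTo : ℕ → List (List Letter)
  allWordsUpTo zero = [] ∷ []
  allWordsUpTo (suc n) =
    [] ∷ (map (σ ∷_) (allWordsUpTo n) ++ (map (τ ∷_) (allWordsUpTo n) ++ map (τ⁻¹ ∷_) (allWordsUpTo n)))

  ∈-allWordsUpTo : ∀ n w → length w ℕ.≤ n → w ∈ allWordsUpTo n
  ∈-allWordsUpTo zero [] _ = here refl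
  ∈-allWordsUpTo (suc n) [] _ = here refl
  ∈-allWordsUpTo (suc n) (σ ∷ w) (ℕ.s≤s ∣w∣≤n) =
    there (∈-++⁺ˡ (∈-map⁺ (σ ∷_) (∈-allWordsUpTo n w ∣w∣≤n)))
  ∈-allWordsUpTo (suc n) (τ ∷ w) (ℕ.s≤s ∣w∣≤n) =
    there (∈-++⁺ʳ (map (σ ∷_) (allWordsUpTo n)) (∈-++⁺ˡ (∈-map⁺ (τ ∷_) (∈-allWordsUpTo n w ∣w∣≤n))))
  ∈-allWordsUpTo (suc n) (τ⁻¹ ∷ w) (ℕ.s≤s ∣w∣≤n) =
    there (∈-++⁺ʳ (map (σ ∷_) (allWordsUpTo n))
            (∈-++⁺ʳ (map (τ ∷_) (allWordsUpTo n)) (∈-map⁺ (τ⁻¹ ∷_) (∈-allWordsUpTo n w ∣w∣≤n))))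

  -- Reduction of words modulo N and Schreier's lemma

  Γ₀⁰ : ℕ → Mat → Set
  Γ₀⁰ N A = det A ≡ 1ℤ × DiagonalMod (+ N) A

  Γ₀⁰? : ∀ N A → Dec (Γ₀⁰ N A)
  Γ₀⁰? N A = (det A ℤ.≟ 1ℤ) ×-dec ((+ N ∣? upperRight A) ×-dec (+ N ∣? lowerLeft A))

  letters : List Letter
  letters = σ ∷ τ ∷ τ⁻¹ ∷ []

  ∈-letters : ∀ l → l ∈ letters
  ∈-letters σ = here refl
  ∈-letters τ = there (here refl)
  ∈-letters τ⁻¹ = there (there (here refl))

  module WordsModulo (N : ℕ) .{{_ : ℕ.NonZero N}} where

    residue : ℤ → Fin N
    residue a = fromℕ< (n%d<d a (+ N))

    residue-injective : ∀ a a′ → residue a ≡ residue a′ → ∃[ p ] a ≡ a′ + + N * p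
    residue-injective a a′ same = ℤ-residue-injective N a a′
      (trans (sym (FinP.toℕ-fromℕ< (n%d<d a (+ N)))) (trans (cong toℕ same) (FinP.toℕ-fromℕ< (n%d<d a′ (+ N)))))

    #residues : ℕ
    #residues = N ℕ.* (N ℕ.* (N ℕ.* N))

    code : Mat → Fin #residues
    code (mat a b c d) = combine (residue a) (combine (residue b) (combine (residue c) (residue d)))

    code-injective : ∀ A B → code A ≡ code B → A ≡ B [mod + N ]
    code-injective (mat a b c d) (mat a′ b′ c′ d′) same
      with FinP.combine-injective _ _ _ _ same
    ... | ra , same′ with FinP.combine-injective _ _ _ _ same′
    ... | rb , same″ with FinP.combine-injective _ _ _ _ same″
    ... | rc , rd with residue-injective a a′ ra | residue-injective b b′ rb
                     | residue-injective c c′ rc | residue-injective d d′ rd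
    ... | p , ea | q , eb | r , ec | s , ed = p , q , r , s , ea , eb , ec , ed

    -- Among the #residues + 1 suffixes of a long word two agree modulo N; cutting out
    -- the letters between them does not change the word modulo N.
    shorten-once : ∀ w → #residues ℕ.< length w →
      ∃[ w′ ] length w′ ℕ.< length w × eval w′ ≡ eval w [mod + N ]
    shorten-once w long
      with FinP.pigeonhole (ℕP.n<1+n #residues) (λ (i : Fin (suc #residues)) → code (eval (drop (toℕ i) w)))
    ... | i , j , i<j , same = take (toℕ i) w ++ drop (toℕ j) w , shorter , congruent
      where
      j≤∣w∣ : toℕ j ℕ.≤ length w
      j≤∣w∣ = ℕP.≤-trans (ℕP.≤-pred (FinP.toℕ<n j)) (ℕP.<⇒≤ long)
      shorter : length (take (toℕ i) w ++ drop (toℕ j) w) ℕ.< length w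
      shorter = begin-strict
        length (take (toℕ i) w ++ drop (toℕ j) w)  ≡⟨ ListP.length-++ (take (toℕ i) w) ⟩
        length (take (toℕ i) w) ℕ.+ length (drop (toℕ j) w)
          ≡⟨ cong₂ ℕ._+_ (ListP.length-take (toℕ i) w) (ListP.length-drop (toℕ j) w) ⟩
        toℕ i ⊓ length w ℕ.+ (length w ∸ toℕ j)
          <⟨ ℕP.+-monoˡ-< (length w ∸ toℕ j) (ℕP.≤-<-trans (ℕP.m⊓n≤m (toℕ i) (length w)) i<j) ⟩
        toℕ j ℕ.+ (length w ∸ toℕ j)             ≡⟨ ℕP.m+[n∸m]≡n j≤∣w∣ ⟩
        length w                                 ∎
        where open ℕP.≤-Reasoning
      congruent : eval (take (toℕ i) w ++ drop (toℕ j) w) ≡ eval w [mod + N ]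
      congruent = subst₂ (_≡_[mod + N ]) (sym (eval-++ (take (toℕ i) w) (drop (toℕ j) w)))
        (trans (sym (eval-++ (take (toℕ i) w) (drop (toℕ i) w))) (cong eval (ListP.take++drop≡id (toℕ i) w)))
        (≡-mod-⊗ˡ (+ N) _ _ (eval (take (toℕ i) w)) (code-injective _ _ (sym same)))

    shortWords : List (List Letter)
    shortWords = allWordsUpTo #residues

    shorten : ∀ w → ∃[ w′ ] w′ ∈ shortWords × eval w′ ≡ eval w [mod + N ]
    shorten w = go (length w) w ℕP.≤-refl
      where
      go : ∀ n w → length w ℕ.≤ n → ∃[ w′ ] w′ ∈ shortWords × eval w′ ≡ eval w [mod + N ]
      go n w ∣w∣≤n with length w ℕ.≤? #residues
      ... | yes short = w , ∈-allWordsUpTo #residues w short , ≡-mod-refl (+ N) (eval w)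
      go zero w ∣w∣≤0 | no long = ⊥-elim (long (ℕP.≤-trans ∣w∣≤0 ℕ.z≤n))
      go (suc n) w ∣w∣≤n | no long with shorten-once w (ℕP.≰⇒> long)
      ... | w′ , shorter , w′≡w with go n w′ (ℕP.≤-pred (ℕP.≤-trans shorter ∣w∣≤n))
      ... | w″ , short , w″≡w′ = w″ , short , ≡-mod-trans (+ N) _ _ _ w″≡w′ w′≡w

    schreierCandidate : List Letter × Letter × List Letter → Mat
    schreierCandidate (w₁ , l , w₂) = adj (eval w₁) ⊗ (⟦ l ⟧ ⊗ eval w₂)

    schreierCandidates : List Mat
    schreierCandidates = map schreierCandidate (cartesianProduct shortWords (cartesianProduct letters shortWords))

    schreierGenerators : List Mat
    schreierGenerators = filter (Γ₀⁰? N) schreierCandidates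

    -- Schreier's lemma for Γ₀⁰(N), with the short words as coset representatives.
    schreier : (P : Mat → Set) → P I → (∀ {A B} → P A → P B → P (A ⊗ B)) →
      (∀ {f} → f ∈ schreierGenerators → P f) →
      ∀ w → ∃[ w′ ] w′ ∈ shortWords × eval w′ ≡ eval w [mod + N ] × ∃[ X ] P X × eval w ≡ eval w′ ⊗ X
    schreier P P-I P-⊗ P-gen [] =
      [] , ∈-allWordsUpTo #residues [] ℕ.z≤n , ≡-mod-refl (+ N) I , I , P-I , sym (⊗-identityˡ I)
    schreier P P-I P-⊗ P-gen (l ∷ w)
      with schreier P P-I P-⊗ P-gen w | shorten (l ∷ w)
    ... | w′ , w′∈short , w′≡w , X , P-X , w=w′X | w₁ , w₁∈short , w₁≡lw =
      w₁ , w₁∈short , w₁≡lw , f ⊗ X , P-⊗ (P-gen f∈gens) P-X , factor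
      where
      f : Mat
      f = schreierCandidate (w₁ , l , w′)
      f≡I : f ≡ I [mod + N ]
      f≡I = subst (f ≡_[mod + N ]) (adj-inverseˡ (eval (l ∷ w)) (det-eval (l ∷ w)))
        (≡-mod-⊗ (+ N) _ _ _ _ (≡-mod-adj (+ N) _ _ w₁≡lw) (≡-mod-⊗ˡ (+ N) _ _ ⟦ l ⟧ w′≡w))
      f∈Γ₀⁰ : Γ₀⁰ N f
      f∈Γ₀⁰ = trans (det-⊗ (adj (eval w₁)) (eval (l ∷ w′)))
                (cong₂ _*_ (trans (det-adj (eval w₁)) (det-eval w₁)) (det-eval (l ∷ w′))) ,
              ≡I-mod⇒DiagonalMod (+ N) f f≡I
      f∈gens : f ∈ schreierGenerators
      f∈gens = ∈-filter⁺ (Γ₀⁰? N)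
        (∈-map⁺ schreierCandidate (∈-cartesianProduct⁺ w₁∈short (∈-cartesianProduct⁺ (∈-letters l) w′∈short)))
        f∈Γ₀⁰
      factor : eval (l ∷ w) ≡ eval w₁ ⊗ (f ⊗ X)
      factor = begin
        ⟦ l ⟧ ⊗ eval w                               ≡⟨ cong (⟦ l ⟧ ⊗_) w=w′X ⟩
        ⟦ l ⟧ ⊗ (eval w′ ⊗ X)                        ≡⟨ sym (⊗-assoc ⟦ l ⟧ (eval w′) X) ⟩
        (⟦ l ⟧ ⊗ eval w′) ⊗ X                        ≡⟨ cong (_⊗ X) (sym (adj-cancelˡ (⟦ l ⟧ ⊗ eval w′) (eval w₁) (det-eval w₁))) ⟩
        (eval w₁ ⊗ f) ⊗ X                            ≡⟨ ⊗-assoc (eval w₁) f X ⟩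
        eval w₁ ⊗ (f ⊗ X)                            ∎
        where open ≡-Reasoning

  Comaximal : ℤ → ℤ → Set
  Comaximal a b = ∃[ u ] ∃[ v ] u * a + v * b ≡ 1ℤ

  comaximal-sym : ∀ {a b} → Comaximal a b → Comaximal b a
  comaximal-sym {a} {b} (u , v , e) = v , u , trans (ℤP.+-comm (v * b) (u * a)) e

  comaximal-*ˡ : ∀ {a b c} → Comaximal a c → Comaximal b c → Comaximal (a * b) c
  comaximal-*ˡ {a} {b} {c} (u , v , e) (u′ , v′ , e′) =
    u * u′ , u * a * v′ + v * u′ * b + v * v′ * c , trans (expand u v u′ v′ a b c) (cong₂ _*_ e e′)
    where
    expand : ∀ u v u′ v′ a b c →
      u * u′ * (a * b) + (u * a * v′ + v * u′ * b + v * v′ * c) * c ≡ (u * a + v * c) * (u′ * b + v′ * c)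
    expand = solve-∀

  comaximal-*ʳ : ∀ {a b c} → Comaximal a b → Comaximal a c → Comaximal a (b * c)
  comaximal-*ʳ ab ac = comaximal-sym (comaximal-*ˡ (comaximal-sym ab) (comaximal-sym ac))

  comaximal-^ʳ : ∀ {a b} → Comaximal a b → ∀ k → Comaximal a (b ^ k)
  comaximal-^ʳ {a} ab zero = 0ℤ , 1ℤ , trivial a
    where
    trivial : ∀ a → 0ℤ * a + 1ℤ * 1ℤ ≡ 1ℤ
    trivial = solve-∀
  comaximal-^ʳ ab (suc k) = comaximal-*ʳ ab (comaximal-^ʳ ab k)

  comaximal-∣ʳ : ∀ {a b c} → Comaximal a b → c ∣ b → Comaximal a c
  comaximal-∣ʳ {a} (u , v , e) (divides q refl) = u , v * q , trans (regroup u v a q _) e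
    where
    regroup : ∀ u v a q c → u * a + (v * q) * c ≡ u * a + v * (q * c)
    regroup = solve-∀

  comaximal-+-multiple : ∀ {a n c} → Comaximal a n → n ∣ c → Comaximal (a + c) n
  comaximal-+-multiple {a} {n} (u , v , e) (divides q refl) = u , v - u * q , trans (regroup u v a q n) e
    where
    regroup : ∀ u v a q n → u * (a + q * n) + (v - u * q) * n ≡ u * a + v * n
    regroup = solve-∀

  1+ab≡cd⇒cd-ab≡1 : ∀ a b c d → 1 ℕ.+ a ℕ.* b ≡ c ℕ.* d → + c * + d + - (+ a) * + b ≡ 1ℤ
  1+ab≡cd⇒cd-ab≡1 a b c d 1+ab≡cd = begin
    + c * + d + - (+ a) * + b                  ≡⟨ cong (_+ - (+ a) * + b) (sym lifted) ⟩
    (1ℤ + + a * + b) + - (+ a) * + b           ≡⟨ cancel (+ a) (+ b) ⟩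
    1ℤ                                         ∎
    where
    open ≡-Reasoning
    lifted : 1ℤ + + a * + b ≡ + c * + d
    lifted = trans (cong (λ z → 1ℤ + z) (sym (ℤP.pos-* a b))) (trans (cong +_ 1+ab≡cd) (ℤP.pos-* c d))
    cancel : ∀ a b → (1ℤ + a * b) + - a * b ≡ 1ℤ
    cancel = solve-∀

  Coprime⇒Comaximal : ∀ {m n} → Coprime m n → Comaximal (+ m) (+ n)
  Coprime⇒Comaximal {m} {n} m⊥n with coprime-Bézout m⊥n
  ... | Bézout.+- x y eq = + x , - (+ y) , 1+ab≡cd⇒cd-ab≡1 y n x m eq
  ... | Bézout.-+ x y eq = comaximal-sym (+ y , - (+ x) , 1+ab≡cd⇒cd-ab≡1 x m y n eq)

  Comaximal⇒Coprime : ∀ {m n} → Comaximal (+ m) (+ n) → Coprime m n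
  Comaximal⇒Coprime (u , v , e) {d} (d∣m , d∣n) =
    ℕD.∣1⇒≡1 (∣⇒∣ᵤ (subst (+ d ∣_) e (∣m∣n⇒∣m+n (∣n⇒∣m*n u (∣ᵤ⇒∣ d∣m)) (∣n⇒∣m*n v (∣ᵤ⇒∣ d∣n)))))

  -- Repeatedly divide n by gcd(n, a) until the quotient is coprime to a.
  coprime-split : ∀ a fuel n → n ℕ.≤ fuel → 0 ℕ.< n →
    ∃[ n′ ] ∃[ r ] ∃[ k ] n ≡ n′ ℕ.* r × Comaximal (+ n′) a × (+ r) ∣ a ^ k
  coprime-split a zero n n≤0 0<n = ⊥-elim (ℕP.<⇒≱ 0<n n≤0)
  coprime-split a (suc fuel) n n≤fuel 0<n with gcd n ∣ a ∣ ℕ.≟ 1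
  ... | yes g≡1 =
    n , 1 , 0 , sym (ℕP.*-identityʳ n) , comaximal-∣ʳ (Coprime⇒Comaximal (gcd≡1⇒coprime g≡1)) m∣∣m∣ , ∣-refl
  ... | no g≢1 with gcd[m,n]∣m n ∣ a ∣
  ... | ℕD.divides q n≡qg
    with coprime-split a fuel q (ℕP.≤-pred (ℕP.≤-trans q<n n≤fuel)) 0<q
    where
    g : ℕ
    g = gcd n ∣ a ∣
    1<g : 1 ℕ.< g
    1<g = ℕP.≤∧≢⇒< (ℕP.n≢0⇒n>0 (gcd[m,n]≢0 n ∣ a ∣ (inj₁ (ℕP.>⇒≢ 0<n)))) (λ 1≡g → g≢1 (sym 1≡g))
    0<q : 0 ℕ.< q
    0<q = ℕP.n≢0⇒n>0 (λ { refl → ℕP.>⇒≢ 0<n n≡qg })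
    q<n : q ℕ.< n
    q<n = subst (q ℕ.<_) (sym n≡qg) (ℕP.m<m*n q g {{ℕ.>-nonZero 0<q}} 1<g)
  ... | n′ , r , k , q≡n′r , n′⊥a , r∣aᵏ =
    n′ , r ℕ.* gcd n ∣ a ∣ , suc k , n≡n′[rg] , n′⊥a , rg∣aᵏ⁺¹
    where
    g : ℕ
    g = gcd n ∣ a ∣
    n≡n′[rg] : n ≡ n′ ℕ.* (r ℕ.* g)
    n≡n′[rg] = trans n≡qg (trans (cong (ℕ._* g) q≡n′r) (ℕP.*-assoc n′ r g))
    g∣a : (+ g) ∣ a
    g∣a = ∣ᵤ⇒∣ (gcd[m,n]∣n n ∣ a ∣)
    rg∣aᵏ⁺¹ : (+ (r ℕ.* g)) ∣ a ^ suc k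
    rg∣aᵏ⁺¹ = subst₂ _∣_ (sym (ℤP.pos-* r g)) (ℤP.*-comm (a ^ k) a)
      (∣-trans (*-monoˡ-∣ (+ g) r∣aᵏ) (*-monoʳ-∣ (a ^ k) g∣a))

  -- With n = n′ r as in coprime-split, t = n′ works: a + n′ b is coprime to n′ because a is,
  -- and coprime to a, hence to r.
  comaximal-shift : ∀ {a b} n → 0 ℕ.< n → Comaximal a b → ∃[ t ] Comaximal (a + t * b) (+ n)
  comaximal-shift {a} {b} n 0<n ab with coprime-split a n n ℕP.≤-refl 0<n
  ... | n′ , r , k , n≡n′r , n′⊥a , r∣aᵏ =
    + n′ , subst (Comaximal x) (sym (trans (cong +_ n≡n′r) (ℤP.pos-* n′ r))) (comaximal-*ʳ x⊥n′ x⊥r)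
    where
    x : ℤ
    x = a + + n′ * b
    x⊥n′ : Comaximal x (+ n′)
    x⊥n′ = comaximal-+-multiple (comaximal-sym n′⊥a) (∣m⇒∣m*n b ∣-refl)
    x⊥a : Comaximal x a
    x⊥a = subst (λ y → Comaximal y a) (ℤP.+-comm (+ n′ * b) a)
      (comaximal-+-multiple (comaximal-*ˡ n′⊥a (comaximal-sym ab)) ∣-refl)
    x⊥r : Comaximal x (+ r)
    x⊥r = comaximal-∣ʳ (comaximal-^ʳ x⊥a k) r∣aᵏ

  -- Generators of Γ₀(M) conjugate to Atkin–Lehner matrices

  antidiagonal-⊗-adj : ∀ k h g → DiagonalMod k h → AntidiagonalMod k g → AntidiagonalMod k (h ⊗ adj g)
  antidiagonal-⊗-adj k (mat a b c d) (mat e f g h) (k∣b , k∣c) (k∣e , k∣h) =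
    ∣m∣n⇒∣m+n (∣n⇒∣m*n a k∣h) (∣m⇒∣m*n (- g) k∣b) , ∣m∣n⇒∣m+n (∣m⇒∣m*n (- f) k∣c) (∣n⇒∣m*n d k∣e)

  conjugate-γ : ∀ K a b c d → Kγ⁻¹ K ⊗ mat a b c d ⊗ γ K ≡ mat (a * + K) b (+ K * c * + K) (+ K * d)
  conjugate-γ K a b c d = mat-≡ (e₁ (+ K) a b c d) (e₂ (+ K) a b c d) (e₃ (+ K) a b c d) (e₄ (+ K) a b c d)
    where
    e₁ : ∀ k a b c d → (1ℤ * a + 0ℤ * c) * k + (1ℤ * b + 0ℤ * d) * 0ℤ ≡ a * k
    e₁ = solve-∀
    e₂ : ∀ k a b c d → (1ℤ * a + 0ℤ * c) * 0ℤ + (1ℤ * b + 0ℤ * d) * 1ℤ ≡ b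
    e₂ = solve-∀
    e₃ : ∀ k a b c d → (0ℤ * a + k * c) * k + (0ℤ * b + k * d) * 0ℤ ≡ k * c * k
    e₃ = solve-∀
    e₄ : ∀ k a b c d → (0ℤ * a + k * c) * 0ℤ + (0ℤ * b + k * d) * 1ℤ ≡ k * d
    e₄ = solve-∀

  det-conjugate-γ : ∀ K A → det (Kγ⁻¹ K ⊗ A ⊗ γ K) ≡ det A * + (K ℕ.* K)
  det-conjugate-γ K A = begin
    det (Kγ⁻¹ K ⊗ A ⊗ γ K)                  ≡⟨ det-⊗ (Kγ⁻¹ K ⊗ A) (γ K) ⟩
    det (Kγ⁻¹ K ⊗ A) * det (γ K)            ≡⟨ cong (_* det (γ K)) (det-⊗ (Kγ⁻¹ K) A) ⟩
    det (Kγ⁻¹ K) * det A * det (γ K)        ≡⟨ regroup (+ K) (det A) ⟩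
    det A * (+ K * + K)                     ≡⟨ cong (det A *_) (sym (ℤP.pos-* K K)) ⟩
    det A * + (K ℕ.* K)                     ∎
    where
    open ≡-Reasoning
    regroup : ∀ k d → (1ℤ * k - 0ℤ * 0ℤ) * d * (k * 1ℤ - 0ℤ * 0ℤ) ≡ d * (k * k)
    regroup = solve-∀

  Γ₀-antidiagonal⇒isAL : ∀ K M A → Coprime (K ℕ.* K) M → Γ₀ M A → AntidiagonalMod (+ K) A →
    IsAL (M ℕ.* (K ℕ.* K)) (K ℕ.* K) (Kγ⁻¹ K ⊗ A ⊗ γ K)
  Γ₀-antidiagonal⇒isAL K M A@(mat _ b _ _) K²⊥M (det≡1 , divides z refl) (divides x refl , divides w refl) =
    (M , ℕP.*-comm M (K ℕ.* K) , K²⊥M) ,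
    (x , b , z , w , trans (conjugate-γ K (x * + K) b (z * + M) (w * + K)) (mat-≡ ax refl cz dw)) ,
    trans (det-conjugate-γ K A) (trans (cong (_* + (K ℕ.* K)) det≡1) (ℤP.*-identityˡ (+ (K ℕ.* K))))
    where
    k : ℤ
    k = + K
    K² : + (K ℕ.* K) ≡ k * k
    K² = ℤP.pos-* K K
    MK² : + (M ℕ.* (K ℕ.* K)) ≡ + M * (k * k)
    MK² = trans (ℤP.pos-* M (K ℕ.* K)) (cong (+ M *_) K²)
    e₁ : ∀ x k → x * k * k ≡ (k * k) * x
    e₁ = solve-∀
    e₃ : ∀ z m k → k * (z * m) * k ≡ (m * (k * k)) * z
    e₃ = solve-∀
    e₄ : ∀ w k → k * (w * k) ≡ (k * k) * w
    e₄ = solve-∀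
    ax : x * k * k ≡ + (K ℕ.* K) * x
    ax = trans (e₁ x k) (cong (_* x) (sym K²))
    cz : k * (z * + M) * k ≡ + (M ℕ.* (K ℕ.* K)) * z
    cz = trans (e₃ z (+ M) k) (cong (_* z) (sym MK²))
    dw : k * (w * k) ≡ + (K ℕ.* K) * w
    dw = trans (e₄ w k) (cong (_* w) (sym K²))

  Γ₀? : ∀ M A → Dec (Γ₀ M A)
  Γ₀? M A = (det A ℤ.≟ 1ℤ) ×-dec (+ M ∣? lowerLeft A)

  module Generators (K M : ℕ) .{{_ : ℕ.NonZero (M ℕ.* K)}}
                    (u v : ℤ) (uM+vK²≡1 : u * + M + v * (+ K * + K) ≡ 1ℤ) where

    open WordsModulo (M ℕ.* K)

    k : ℤ
    k = + K

    S′ : Mat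
    S′ = mat (k * v) (- 1ℤ) (+ M * u) k

    S′∈Γ₀ : Γ₀ M S′
    S′∈Γ₀ = trans (expand k (+ M) u v) uM+vK²≡1 , divides u (ℤP.*-comm (+ M) u)
      where
      expand : ∀ k m u v → (k * v) * k - (- 1ℤ) * (m * u) ≡ u * m + v * (k * k)
      expand = solve-∀

    S′-antidiagonal : AntidiagonalMod k S′
    S′-antidiagonal = divides v (ℤP.*-comm k v) , divides 1ℤ (sym (ℤP.*-identityˡ k))

    S′≡S : S′ ≡ S [mod k ]
    S′≡S = v , 0ℤ , - (k * v) , 1ℤ , e₁ k v , e₂ k , e₃ , e₄ k
      where
      e₁ : ∀ k v → k * v ≡ 0ℤ + k * v
      e₁ = solve-∀
      e₂ : ∀ k → - 1ℤ ≡ - 1ℤ + k * 0ℤ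
      e₂ = solve-∀
      e₄ : ∀ k → k ≡ 0ℤ + k * 1ℤ
      e₄ = solve-∀
      regroup : ∀ k m u v → m * u ≡ (u * m + v * (k * k)) + k * (- (k * v))
      regroup = solve-∀
      e₃ : + M * u ≡ 1ℤ + k * (- (k * v))
      e₃ = trans (regroup k (+ M) u v) (cong (_+ k * (- (k * v))) uM+vK²≡1)

    ⟦_⟧′ : Letter → Mat
    ⟦ σ ⟧′ = S′
    ⟦ τ ⟧′ = T
    ⟦ τ⁻¹ ⟧′ = adj T

    eval′ : List Letter → Mat
    eval′ [] = I
    eval′ (l ∷ w) = ⟦ l ⟧′ ⊗ eval′ w

    eval′≡eval : ∀ w → eval′ w ≡ eval w [mod k ]
    eval′≡eval [] = ≡-mod-refl k I
    eval′≡eval (l ∷ w) = ≡-mod-⊗ k _ _ _ _ (letter l) (eval′≡eval w)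
      where
      letter : ∀ l → ⟦ l ⟧′ ≡ ⟦ l ⟧ [mod k ]
      letter σ = S′≡S
      letter τ = ≡-mod-refl k T
      letter τ⁻¹ = ≡-mod-refl k (adj T)

    eval′∈Γ₀ : ∀ w → Γ₀ M (eval′ w)
    eval′∈Γ₀ [] = Γ₀-I
    eval′∈Γ₀ (l ∷ w) = Γ₀-⊗ ⟦ l ⟧′ (eval′ w) (letter l) (eval′∈Γ₀ w)
      where
      letter : ∀ l → Γ₀ M ⟦ l ⟧′
      letter σ = S′∈Γ₀
      letter τ = refl , divides 0ℤ refl
      letter τ⁻¹ = refl , divides 0ℤ refl

    Γ₀?-eval : ∀ w → Dec (Γ₀ M (eval w))
    Γ₀?-eval w = Γ₀? M (eval w)

    correction : List Letter → Mat
    correction w = adj (eval′ w) ⊗ eval w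

    corrections : List Mat
    corrections = map correction (filter Γ₀?-eval shortWords)

    diagonalGenerators : List Mat
    diagonalGenerators = schreierGenerators ++ corrections

    generators : List Mat
    generators = S′ ∷ map (_⊗ adj S′) diagonalGenerators

    diagonalGenerators-diagonal : ∀ {h} → h ∈ diagonalGenerators → Γ₀ M h × DiagonalMod k h
    diagonalGenerators-diagonal {h} h∈ with ∈-++⁻ schreierGenerators h∈
    ... | inj₁ h∈schreier with ∈-filter⁻ (Γ₀⁰? (M ℕ.* K)) {xs = schreierCandidates} h∈schreier
    ...   | _ , det≡1 , N∣b , N∣c = (det≡1 , ∣-trans M∣N N∣c) , ∣-trans K∣N N∣b , ∣-trans K∣N N∣c
      where
      M∣N : + M ∣ + (M ℕ.* K)
      M∣N = divides k (trans (ℤP.pos-* M K) (ℤP.*-comm (+ M) k))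
      K∣N : k ∣ + (M ℕ.* K)
      K∣N = divides (+ M) (ℤP.pos-* M K)
    diagonalGenerators-diagonal {h} h∈ | inj₂ h∈corrections with ∈-map⁻ correction h∈corrections
    ... | w , w∈ , refl = Γ₀-⊗ (adj (eval′ w)) (eval w) (Γ₀-adj (eval′ w) (eval′∈Γ₀ w)) w∈Γ₀ ,
                          ≡I-mod⇒DiagonalMod k (correction w) h≡I
      where
      w∈Γ₀ : Γ₀ M (eval w)
      w∈Γ₀ = proj₂ (∈-filter⁻ Γ₀?-eval {xs = shortWords} w∈)
      h≡I : correction w ≡ I [mod k ]
      h≡I = subst (correction w ≡_[mod k ]) (adj-inverseˡ (eval w) (det-eval w))
        (≡-mod-⊗ʳ k _ _ (eval w) (≡-mod-adj k _ _ (eval′≡eval w)))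

    ConjugateIsAL : Mat → Set
    ConjugateIsAL g = InΓ₀ M g × IsAL (M ℕ.* (K ℕ.* K)) (K ℕ.* K) (Kγ⁻¹ K ⊗ g ⊗ γ K)

    generators-isAL : Coprime (K ℕ.* K) M → All ConjugateIsAL generators
    generators-isAL K²⊥M = good S′ S′∈Γ₀ S′-antidiagonal All.∷ All.tabulate lifted
      where
      good : ∀ g → Γ₀ M g → AntidiagonalMod k g → ConjugateIsAL g
      good g g∈Γ₀ antidiagonal = Γ₀⇒InΓ₀ g g∈Γ₀ , Γ₀-antidiagonal⇒isAL K M g K²⊥M g∈Γ₀ antidiagonal
      lifted : ∀ {g} → g ∈ map (_⊗ adj S′) diagonalGenerators → ConjugateIsAL g
      lifted g∈ with ∈-map⁻ (_⊗ adj S′) g∈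
      ... | h , h∈ , refl with diagonalGenerators-diagonal h∈
      ... | h∈Γ₀ , diagonal =
        good (h ⊗ adj S′) (Γ₀-⊗ h (adj S′) h∈Γ₀ (Γ₀-adj S′ S′∈Γ₀))
          (antidiagonal-⊗-adj k h S′ diagonal S′-antidiagonal)

    Gen-diagonalGenerator : ∀ {h} → h ∈ diagonalGenerators → Gen (T ∷ generators) h
    Gen-diagonalGenerator {h} h∈ = subst (Gen _) (⊗-adj-cancelʳ h S′ (proj₁ S′∈Γ₀))
      (Gen-⊗ (Gen-∈ (there (there (∈-map⁺ (_⊗ adj S′) h∈)))) (Gen-∈ (there (here refl))))

    Gen-eval′ : ∀ w → Gen (T ∷ generators) (eval′ w)
    Gen-eval′ [] = gen-id
    Gen-eval′ (l ∷ w) = Gen-⊗ (letter l) (Gen-eval′ w)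
      where
      letter : ∀ l → Gen (T ∷ generators) ⟦ l ⟧′
      letter σ = Gen-∈ (there (here refl))
      letter τ = Gen-∈ (here refl)
      letter τ⁻¹ = Gen-adj (here refl)

    generators⊆Γ₀ : ∀ {g} → g ∈ T ∷ generators → Γ₀ M g
    generators⊆Γ₀ (here refl) = refl , divides 0ℤ refl
    generators⊆Γ₀ (there (here refl)) = S′∈Γ₀
    generators⊆Γ₀ (there (there g∈)) with ∈-map⁻ (_⊗ adj S′) g∈
    ... | h , h∈ , refl = Γ₀-⊗ h (adj S′) (proj₁ (diagonalGenerators-diagonal h∈)) (Γ₀-adj S′ S′∈Γ₀)

    Γ₀⇒Gen : ∀ g → Γ₀ M g → Gen (T ∷ generators) g
    Γ₀⇒Gen g g∈Γ₀@(det≡1 , _) with SL₂-word (suc ∣ lowerLeft g ∣) g ℕP.≤-refl det≡1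
    ... | w , eval-w≡g
      with schreier (Gen (T ∷ generators)) gen-id Gen-⊗ (λ f∈ → Gen-diagonalGenerator (∈-++⁺ˡ f∈)) w
    ... | w′ , w′∈short , _ , X , X∈Gen , w≡w′X = subst (Gen _) g≡w′X (Gen-⊗ w′∈Gen X∈Gen)
      where
      g≡w′X : eval w′ ⊗ X ≡ g
      g≡w′X = trans (sym w≡w′X) eval-w≡g
      X∈Γ₀ : Γ₀ M X
      X∈Γ₀ = Gen⇒Γ₀ generators⊆Γ₀ X∈Gen
      w′∈Γ₀ : Γ₀ M (eval w′)
      w′∈Γ₀ = subst (Γ₀ M) (⊗-cancelʳ (eval w′) X (proj₁ X∈Γ₀))
        (Γ₀-⊗ (eval w′ ⊗ X) (adj X) (subst (Γ₀ M) (sym g≡w′X) g∈Γ₀) (Γ₀-adj X X∈Γ₀))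
      correction∈ : correction w′ ∈ diagonalGenerators
      correction∈ = ∈-++⁺ʳ schreierGenerators (∈-map⁺ correction (∈-filter⁺ Γ₀?-eval w′∈short w′∈Γ₀))
      w′∈Gen : Gen (T ∷ generators) (eval w′)
      w′∈Gen = subst (Gen _) (adj-cancelˡ (eval w′) (eval′ w′) (proj₁ (eval′∈Γ₀ w′)))
        (Gen-⊗ (Gen-eval′ w′) (Gen-diagonalGenerator correction∈))

    InΓ₀⇔Gen : ∀ g → InΓ₀ M g ⇔ Gen (T ∷ generators) g
    InΓ₀⇔Gen g = mk⇔ (λ g∈ → Γ₀⇒Gen g (InΓ₀⇒Γ₀ g g∈)) (λ g∈ → Γ₀⇒InΓ₀ g (Gen⇒Γ₀ generators⊆Γ₀ g∈))

  generation : ∀ K M → 0 ℕ.< K → 0 ℕ.< M → Coprime K M →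
    ∃[ gs ] (All (λ g → InΓ₀ M g × IsAL (M ℕ.* (K ℕ.* K)) (K ℕ.* K) (Kγ⁻¹ K ⊗ g ⊗ γ K)) gs
             × (∀ g → InΓ₀ M g ⇔ Gen (T ∷ gs) g))
  generation K M 0<K 0<M K⊥M = generators , generators-isAL K²⊥M , InΓ₀⇔Gen
    where
    K⊥ℤM : Comaximal (+ K) (+ M)
    K⊥ℤM = Coprime⇒Comaximal K⊥M
    M⊥K² : Comaximal (+ M) (+ K * + K)
    M⊥K² = comaximal-sym (comaximal-*ˡ K⊥ℤM K⊥ℤM)
    open Generators K M {{ℕP.m*n≢0 M K {{ℕ.>-nonZero 0<M}} {{ℕ.>-nonZero 0<K}}}}
                    (proj₁ M⊥K²) (proj₁ (proj₂ M⊥K²)) (proj₂ (proj₂ M⊥K²))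
    K²⊥M : Coprime (K ℕ.* K) M
    K²⊥M = Comaximal⇒Coprime (subst (λ q → Comaximal q (+ M)) (sym (ℤP.pos-* K K)) (comaximal-sym M⊥K²))

  -- Double cosets of W_m

  lowerShear : ℤ → Mat
  lowerShear c = mat 1ℤ 0ℤ c 1ℤ

  lowerShear∈Γ₀ : ∀ M c → + M ∣ c → Γ₀ M (lowerShear c)
  lowerShear∈Γ₀ M c M∣c = unit c , M∣c
    where
    unit : ∀ c → 1ℤ * 1ℤ - 0ℤ * c ≡ 1ℤ
    unit = solve-∀

  T^∈Γ₀ : ∀ M n → Γ₀ M (T^ n)
  T^∈Γ₀ M n = unit n , divides 0ℤ refl
    where
    unit : ∀ n → 1ℤ * 1ℤ - n * 0ℤ ≡ 1ℤ
    unit = solve-∀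

  lowerShear-⊗ : ∀ m L x y z w t →
    lowerShear (m * L * t) ⊗ mat (m * x) y (m * L * z) (m * w) ≡
    mat (m * x) y (m * L * (z + t * (m * x))) (m * (w + t * L * y))
  lowerShear-⊗ m L x y z w t = mat-≡ (e₁ m L x z t) (e₂ m L y w t) (e₃ m L x z t) (e₄ m L y w t)
    where
    e₁ : ∀ m L x z t → 1ℤ * (m * x) + 0ℤ * (m * L * z) ≡ m * x
    e₁ = solve-∀
    e₂ : ∀ m L y w t → 1ℤ * y + 0ℤ * (m * w) ≡ y
    e₂ = solve-∀
    e₃ : ∀ m L x z t → m * L * t * (m * x) + 1ℤ * (m * L * z) ≡ m * L * (z + t * (m * x))
    e₃ = solve-∀
    e₄ : ∀ m L y w t → m * L * t * y + 1ℤ * (m * w) ≡ m * (w + t * L * y)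
    e₄ = solve-∀

  T^-⊗-T^ : ∀ n j a b c d →
    T^ n ⊗ mat a b c d ⊗ T^ j ≡ mat (a + n * c) ((a + n * c) * j + (b + n * d)) c (c * j + d)
  T^-⊗-T^ n j a b c d = mat-≡ (e₁ n j a b c d) (e₂ n j a b c d) (e₃ n j a b c d) (e₄ n j a b c d)
    where
    e₁ : ∀ n j a b c d → (1ℤ * a + n * c) * 1ℤ + (1ℤ * b + n * d) * 0ℤ ≡ a + n * c
    e₁ = solve-∀
    e₂ : ∀ n j a b c d → (1ℤ * a + n * c) * j + (1ℤ * b + n * d) * 1ℤ ≡ (a + n * c) * j + (b + n * d)
    e₂ = solve-∀
    e₃ : ∀ n j a b c d → (0ℤ * a + 1ℤ * c) * 1ℤ + (0ℤ * b + 1ℤ * d) * 0ℤ ≡ c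
    e₃ = solve-∀
    e₄ : ∀ n j a b c d → (0ℤ * a + 1ℤ * c) * j + (0ℤ * b + 1ℤ * d) * 1ℤ ≡ c * j + d
    e₄ = solve-∀

  -- Translating by T^(-xα) on the left and T^(-wα) on the right multiplies the
  -- diagonal entries m x, m w by 1 - α c = β k.
  T^-translate-antidiagonal : ∀ m x y c w α β k → α * c + β * k ≡ 1ℤ →
    ∃[ b ] T^ (- (x * α)) ⊗ mat (m * x) y (m * c) (m * w) ⊗ T^ (- (w * α)) ≡
           mat (m * k * (x * β)) b (m * c) (m * k * (w * β))
  T^-translate-antidiagonal m x y c w α β k αc+βk≡1 =
    _ , trans (T^-⊗-T^ (- (x * α)) (- (w * α)) (m * x) y (m * c) (m * w)) (mat-≡ e₁ refl refl e₄)
    where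
    open ≡-Reasoning
    cancel : ∀ p → p - p * (α * c) ≡ p * (β * k)
    cancel p = begin
      p - p * (α * c)                ≡⟨ factor p α c ⟩
      p * (1ℤ - α * c)               ≡⟨ cong (λ one → p * (one - α * c)) (sym αc+βk≡1) ⟩
      p * ((α * c + β * k) - α * c)  ≡⟨ simplify p α c β k ⟩
      p * (β * k)                    ∎
      where
      factor : ∀ p α c → p - p * (α * c) ≡ p * (1ℤ - α * c)
      factor = solve-∀
      simplify : ∀ p α c β k → p * ((α * c + β * k) - α * c) ≡ p * (β * k)
      simplify = solve-∀
    e₁ : m * x + - (x * α) * (m * c) ≡ m * k * (x * β)
    e₁ = trans (l₁ m x α c) (trans (cancel (m * x)) (r₁ m x β k))
      where
      l₁ : ∀ m x α c → m * x + - (x * α) * (m * c) ≡ m * x - m * x * (α * c)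
      l₁ = solve-∀
      r₁ : ∀ m x β k → m * x * (β * k) ≡ m * k * (x * β)
      r₁ = solve-∀
    e₄ : m * c * - (w * α) + m * w ≡ m * k * (w * β)
    e₄ = trans (l₄ m w α c) (trans (cancel (m * w)) (r₁ m w β k))
      where
      l₄ : ∀ m w α c → m * c * - (w * α) + m * w ≡ m * w - m * w * (α * c)
      l₄ = solve-∀
      r₁ : ∀ m w β k → m * w * (β * k) ≡ m * k * (w * β)
      r₁ = solve-∀

  ⊗-reassociate : ∀ A B C D E → A ⊗ (B ⊗ C) ⊗ D ⊗ E ≡ A ⊗ (B ⊗ (C ⊗ D) ⊗ E)
  ⊗-reassociate A B C D E = begin
    A ⊗ (B ⊗ C) ⊗ D ⊗ E     ≡⟨ cong (_⊗ E) (⊗-assoc A (B ⊗ C) D) ⟩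
    A ⊗ (B ⊗ C ⊗ D) ⊗ E     ≡⟨ cong (λ X → A ⊗ X ⊗ E) (⊗-assoc B C D) ⟩
    A ⊗ (B ⊗ (C ⊗ D)) ⊗ E   ≡⟨ ⊗-assoc A (B ⊗ (C ⊗ D)) E ⟩
    A ⊗ (B ⊗ (C ⊗ D) ⊗ E)   ∎
    where open ≡-Reasoning

  doubleCoset-conjugate : ∀ K m L x y z w t α β →
    let k = + K ; z₁ = z + t * (m * x) ; w₁ = w + t * L * y in
    α * (L * z₁) + β * k ≡ 1ℤ →
    ∃[ b ] Kγ⁻¹ K ⊗ (T^ (- (x * α)) ⊗ lowerShear (m * L * t)) ⊗ mat (m * x) y (m * L * z) (m * w)
                  ⊗ T^ (- (w₁ * α)) ⊗ γ K
           ≡ mat (m * (k * k) * (x * β)) b (m * L * (k * k) * z₁) (m * (k * k) * (w₁ * β))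
  doubleCoset-conjugate K m L x y z w t α β αLz₁+βk≡1 = proj₁ translated , (begin
    Kγ⁻¹ K ⊗ (T^ n ⊗ lowerShear (m * L * t)) ⊗ mat (m * x) y (m * L * z) (m * w) ⊗ T^ j ⊗ γ K
      ≡⟨ cong (_⊗ γ K) (⊗-reassociate (Kγ⁻¹ K) (T^ n) (lowerShear (m * L * t)) _ (T^ j)) ⟩
    Kγ⁻¹ K ⊗ (T^ n ⊗ (lowerShear (m * L * t) ⊗ mat (m * x) y (m * L * z) (m * w)) ⊗ T^ j) ⊗ γ K
      ≡⟨ cong (λ V → Kγ⁻¹ K ⊗ (T^ n ⊗ V ⊗ T^ j) ⊗ γ K) sheared ⟩
    Kγ⁻¹ K ⊗ (T^ n ⊗ mat (m * x) y (m * (L * z₁)) (m * w₁) ⊗ T^ j) ⊗ γ K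
      ≡⟨ cong (λ V → Kγ⁻¹ K ⊗ V ⊗ γ K) (proj₂ translated) ⟩
    Kγ⁻¹ K ⊗ mat (m * k * (x * β)) b (m * (L * z₁)) (m * k * (w₁ * β)) ⊗ γ K
      ≡⟨ conjugate-γ K (m * k * (x * β)) b (m * (L * z₁)) (m * k * (w₁ * β)) ⟩
    mat (m * k * (x * β) * k) b (k * (m * (L * z₁)) * k) (k * (m * k * (w₁ * β)))
      ≡⟨ mat-≡ (e₁ m k x β) refl (e₃ m L k z₁) (e₁′ m k w₁ β) ⟩
    mat (m * (k * k) * (x * β)) b (m * L * (k * k) * z₁) (m * (k * k) * (w₁ * β)) ∎)
    where
    open ≡-Reasoning
    k z₁ w₁ n j : ℤ
    k = + K
    z₁ = z + t * (m * x)
    w₁ = w + t * L * y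
    n = - (x * α)
    j = - (w₁ * α)
    sheared : lowerShear (m * L * t) ⊗ mat (m * x) y (m * L * z) (m * w) ≡ mat (m * x) y (m * (L * z₁)) (m * w₁)
    sheared = trans (lowerShear-⊗ m L x y z w t) (cong (λ c → mat (m * x) y c (m * w₁)) (ℤP.*-assoc m L z₁))
    translated : ∃[ b ] T^ n ⊗ mat (m * x) y (m * (L * z₁)) (m * w₁) ⊗ T^ j ≡
                        mat (m * k * (x * β)) b (m * (L * z₁)) (m * k * (w₁ * β))
    translated = T^-translate-antidiagonal m x y (L * z₁) w₁ α β k αLz₁+βk≡1
    b : ℤ
    b = proj₁ translated
    e₁ : ∀ m k x β → m * k * (x * β) * k ≡ m * (k * k) * (x * β)
    e₁ = solve-∀
    e₁′ : ∀ m k w β → k * (m * k * (w * β)) ≡ m * (k * k) * (w * β)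
    e₁′ = solve-∀
    e₃ : ∀ m L k z → k * (m * (L * z)) * k ≡ m * L * (k * k) * z
    e₃ = solve-∀

  det-conjugate-γ-⊗ : ∀ K A B C → det A ≡ 1ℤ → det C ≡ 1ℤ →
    det (Kγ⁻¹ K ⊗ A ⊗ B ⊗ C ⊗ γ K) ≡ det B * + (K ℕ.* K)
  det-conjugate-γ-⊗ K A B C detA≡1 detC≡1 = begin
    det (Kγ⁻¹ K ⊗ A ⊗ B ⊗ C ⊗ γ K)      ≡⟨ cong (λ X → det (X ⊗ γ K)) regroup ⟩
    det (Kγ⁻¹ K ⊗ (A ⊗ B ⊗ C) ⊗ γ K)    ≡⟨ det-conjugate-γ K (A ⊗ B ⊗ C) ⟩
    det (A ⊗ B ⊗ C) * + (K ℕ.* K)       ≡⟨ cong (_* + (K ℕ.* K)) det-ABC ⟩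
    det B * + (K ℕ.* K)                 ∎
    where
    open ≡-Reasoning
    regroup : Kγ⁻¹ K ⊗ A ⊗ B ⊗ C ≡ Kγ⁻¹ K ⊗ (A ⊗ B ⊗ C)
    regroup = trans (cong (_⊗ C) (⊗-assoc (Kγ⁻¹ K) A B)) (⊗-assoc (Kγ⁻¹ K) (A ⊗ B) C)
    unit : ∀ b → 1ℤ * b * 1ℤ ≡ b
    unit = solve-∀
    det-ABC : det (A ⊗ B ⊗ C) ≡ det B
    det-ABC = begin
      det (A ⊗ B ⊗ C)          ≡⟨ trans (det-⊗ (A ⊗ B) C) (cong (_* det C) (det-⊗ A B)) ⟩
      det A * det B * det C    ≡⟨ cong₂ (λ p q → p * det B * q) detA≡1 detC≡1 ⟩
      1ℤ * det B * 1ℤ          ≡⟨ unit (det B) ⟩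
      det B                    ∎

  atkinLehner-comaximal : ∀ m L x y z w .{{_ : ℤ.NonZero m}} →
    det (mat (m * x) y (m * L * z) (m * w)) ≡ m → Comaximal z (m * x)
  atkinLehner-comaximal m L x y z w det≡m = - (y * L) , w , ℤP.*-cancelˡ-≡ m _ 1ℤ (begin
    m * (- (y * L) * z + w * (m * x))         ≡⟨ factor m L x y z w ⟩
    m * x * (m * w) - y * (m * L * z)         ≡⟨ det≡m ⟩
    m                                         ≡⟨ ℤP.*-identityʳ m ⟨
    m * 1ℤ                                    ∎)
    where
    open ≡-Reasoning
    factor : ∀ m L x y z w → m * (- (y * L) * z + w * (m * x)) ≡ m * x * (m * w) - y * (m * L * z)
    factor = solve-∀

  atkinLehner-doubleCoset : ∀ K M m W → 0 ℕ.< K → 0 ℕ.< M → Coprime K M → IsAL M m W →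
    ∃[ μ ] ∃[ ν ] (InΓ₀ M μ × InΓ₀ M ν × IsAL (M ℕ.* (K ℕ.* K)) (m ℕ.* (K ℕ.* K)) (Kγ⁻¹ K ⊗ μ ⊗ W ⊗ ν ⊗ γ K))
  atkinLehner-doubleCoset K M zero W _ 0<M _ ((L , M≡0 , _) , _) = ⊥-elim (ℕP.<⇒≢ 0<M (sym M≡0))
  atkinLehner-doubleCoset K M m@(suc _) W 0<K 0<M K⊥M ((L , M≡mL , m⊥L) , (x , y , z , w , refl) , detW) =
    μ , ν , Γ₀⇒InΓ₀ μ μ∈Γ₀ , Γ₀⇒InΓ₀ ν (T^∈Γ₀ M (- (w₁ * α))) ,
    (L , level , mK²⊥L) , (x * β , proj₁ conjugate′ , z₁ , w₁ * β , conjugate) ,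
    det-conjugate
    where
    k m′ L′ : ℤ
    k = + K
    m′ = + m
    L′ = + L
    M≡m′L′ : + M ≡ m′ * L′
    M≡m′L′ = trans (cong +_ M≡mL) (ℤP.pos-* m L)
    W≡ : W ≡ mat (m′ * x) y (m′ * L′ * z) (m′ * w)
    W≡ = cong (λ c → mat (m′ * x) y (c * z) (m′ * w)) M≡m′L′
    shift : ∃[ t ] Comaximal (z + t * (m′ * x)) k
    shift = comaximal-shift K 0<K (atkinLehner-comaximal m′ L′ x y z w (trans (cong det (sym W≡)) detW))
    t z₁ w₁ : ℤ
    t = proj₁ shift
    z₁ = z + t * (m′ * x)
    w₁ = w + t * L′ * y
    K⊥L : Comaximal k L′
    K⊥L = comaximal-∣ʳ (Coprime⇒Comaximal K⊥M) (divides m′ M≡m′L′)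
    Lz₁⊥K : Comaximal (L′ * z₁) k
    Lz₁⊥K = comaximal-*ˡ (comaximal-sym K⊥L) (proj₂ shift)
    α β : ℤ
    α = proj₁ Lz₁⊥K
    β = proj₁ (proj₂ Lz₁⊥K)
    μ ν : Mat
    μ = T^ (- (x * α)) ⊗ lowerShear (m′ * L′ * t)
    ν = T^ (- (w₁ * α))
    μ∈Γ₀ : Γ₀ M μ
    μ∈Γ₀ = Γ₀-⊗ (T^ (- (x * α))) (lowerShear (m′ * L′ * t)) (T^∈Γ₀ M (- (x * α)))
      (lowerShear∈Γ₀ M (m′ * L′ * t) (divides t (trans (ℤP.*-comm (m′ * L′) t) (cong (t *_) (sym M≡m′L′)))))
    mK² : + (m ℕ.* (K ℕ.* K)) ≡ m′ * (k * k)
    mK² = trans (ℤP.pos-* m (K ℕ.* K)) (cong (m′ *_) (ℤP.pos-* K K))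
    conjugate′ : ∃[ b ] Kγ⁻¹ K ⊗ μ ⊗ mat (m′ * x) y (m′ * L′ * z) (m′ * w) ⊗ ν ⊗ γ K
                        ≡ mat (m′ * (k * k) * (x * β)) b (m′ * L′ * (k * k) * z₁) (m′ * (k * k) * (w₁ * β))
    conjugate′ = doubleCoset-conjugate K m′ L′ x y z w t α β (proj₂ (proj₂ Lz₁⊥K))
    conjugate : Kγ⁻¹ K ⊗ μ ⊗ W ⊗ ν ⊗ γ K ≡
      mat (+ (m ℕ.* (K ℕ.* K)) * (x * β)) (proj₁ conjugate′) (+ (M ℕ.* (K ℕ.* K)) * z₁) (+ (m ℕ.* (K ℕ.* K)) * (w₁ * β))
    conjugate = trans (cong (λ V → Kγ⁻¹ K ⊗ μ ⊗ V ⊗ ν ⊗ γ K) W≡) (trans (proj₂ conjugate′)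
      (cong₂ (λ p q → mat (p * (x * β)) (proj₁ conjugate′) (q * z₁) (p * (w₁ * β))) (sym mK²) (sym MK²)))
      where
      MK² : + (M ℕ.* (K ℕ.* K)) ≡ m′ * L′ * (k * k)
      MK² = trans (ℤP.pos-* M (K ℕ.* K)) (cong₂ _*_ M≡m′L′ (ℤP.pos-* K K))
    det-conjugate : det (Kγ⁻¹ K ⊗ μ ⊗ W ⊗ ν ⊗ γ K) ≡ + (m ℕ.* (K ℕ.* K))
    det-conjugate = trans (det-conjugate-γ-⊗ K μ W ν (proj₁ μ∈Γ₀) (proj₁ (T^∈Γ₀ M (- (w₁ * α)))))
      (trans (cong (_* + (K ℕ.* K)) detW) (sym (ℤP.pos-* m (K ℕ.* K))))
    level : M ℕ.* (K ℕ.* K) ≡ m ℕ.* (K ℕ.* K) ℕ.* L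
    level = trans (cong (ℕ._* (K ℕ.* K)) M≡mL) (regroup m L K)
      where
      regroup : ∀ m L K → m ℕ.* L ℕ.* (K ℕ.* K) ≡ m ℕ.* (K ℕ.* K) ℕ.* L
      regroup = ℕ-RingSolver.solve-∀
    mK²⊥L : Coprime (m ℕ.* (K ℕ.* K)) L
    mK²⊥L = Comaximal⇒Coprime (subst (λ q → Comaximal q L′) (sym mK²)
      (comaximal-*ˡ (Coprime⇒Comaximal m⊥L) (comaximal-*ˡ K⊥L K⊥L)))

open import Defs
open import Data.Nat using (ℕ; _<_; _*_; _^_)
open import Data.Nat.Divisibility using (_∣_)
open import Relation.Binary.PropositionalEquality using (_≡_)
open import Data.Nat.Primality using (Prime)
open import Data.Nat.Coprimality using (Coprime)
open import Data.List using (List; _∷_)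
open import Data.List.Relation.Unary.All using (All)
open import Data.Product using (∃-syntax; _×_; _,_)
open import Function.Bundles using (_⇔_)
open import Relation.Nullary using (¬_)
open import Data.Nat.Properties using (≤-trans; n≤1+n)

mainTheorem11 : (K M : ℕ) → 1 < K → 0 < M → Coprime K M →
    (∃[ gs ]
       (All (λ g → InΓ₀ M g × IsAL (M * (K * K)) (K * K) (Kγ⁻¹ K ⊗ g ⊗ γ K)) gs
        × (∀ g → InΓ₀ M g ⇔ Gen (T ∷ gs) g)))
    ×
    (∀ (p e m : ℕ) → Prime p → 0 < e → m ≡ p ^ e → m ∣ M → ¬ (p * m ∣ M) →
       ∀ (W : Mat) → IsAL M m W →
       ∃[ μ ] ∃[ ν ] (InΓ₀ M μ × InΓ₀ M ν
         × IsAL (M * (K * K)) (m * (K * K)) (Kγ⁻¹ K ⊗ μ ⊗ W ⊗ ν ⊗ γ K)))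
mainTheorem11 K M 1<K 0<M K⊥M =
  generation K M 0<K 0<M K⊥M ,
  λ _ _ m _ _ _ _ _ W W-isAL → atkinLehner-doubleCoset K M m W 0<K 0<M K⊥M W-isAL
  where
  0<K : 0 < K
  0<K = ≤-trans (n≤1+n 1) 1<K
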